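{- Let $p$ and $q$ be primes and let $b\geq 2$ be an integer with $q=p^b-p+1$, and let $k,l$ be positive integers. In the game \textsc{nontotient}: (a) if $b$ is even, then $\mathcal{SG}(p^k q^l)=0$ if and only if $k$ is even; (b) if $b$ is odd, then $\mathcal{SG}(p^k q^l)=0$ if and only if $k+l$ is even.
   Context: \textsc{nontotient} is the normal-play impartial game on positive integers in which, for $n\geq 2$, the only option of $n$ is $g(n)=n-\phi(n)$, where $\phi$ is Euler's totient function; the position $1$ is terminal. Since the game has no choices, $\mathcal{SG}(n)\in\{0,1\}$, and $\mathcal{SG}(n)=0$ exactly when the number of moves needed to go from $n$ to the terminal position $1$ is even. -}

module Defs where

open import Data.Nat using (ℕ; zero; suc; _+_; _∸_; _%_)
open import Data.Nat.GCD using (gcd)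
open import Data.List using (List; length; filter)
open import Data.List.Base using (upTo)
open import Data.Nat.Properties using (_≟_)
open import Relation.Nullary.Decidable using (⌊_⌋)
open import Data.Bool using (Bool; true; false)

-- Euler's totient: φ(n) = #{ k | 1 ≤ k ≤ n, gcd k n = 1 }  (φ 0 = 0)
φ : ℕ → ℕ
φ n = length (filter (λ k → gcd (suc k) n ≟ 1) (upTo n))

g : ℕ → ℕ
g n = n ∸ φ n

-- number of moves from n to the terminal position 1, computed with fuel.
-- For n ≥ 1 we have g n < n (since φ n ≥ 1), so fuel n suffices.
movesFuel : ℕ → ℕ → ℕ
movesFuel zero n = 0
movesFuel (suc f) zero = 0
movesFuel (suc f) (suc zero) = 0
movesFuel (suc f) (suc (suc n)) = suc (movesFuel f (g (suc (suc n))))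

moves : ℕ → ℕ
moves n = movesFuel n n

-- Sprague–Grundy value of position n (game has no choices): parity of moves
SG : ℕ → ℕ
SG n = moves n % 2

-- φ(p^(a+1)) = p^(a+1) − p^a and, by inclusion–exclusion, φ(p^(a+1) q^(c+1)) = N − N/p − N/q + N/(pq);
-- hence g(p^(a+1)) = p^a and g(p^(a+1) q^(c+1)) = p^a q^c (p + q − 1) = p^(a+b) q^c when p + q = p^b + 1.
-- So each move from p^k q^l either lowers the exponent of q by one and raises that of p by b − 1, or,
-- once q is gone, lowers the exponent of p by one: p^k q^l reaches 1 after exactly k + l b moves,
-- a number with the parity of k when b is even and of k + l when b is odd.
module Submission where

open import Defs
open import Data.Nat
open import Data.Nat.Properties
open import Data.Nat.DivMod using (%-distribˡ-+; %-distribˡ-*; m%n%n≡m%n)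
open import Data.Nat.Divisibility
open import Data.Nat.GCD using (gcd; gcd-greatest; gcd-zeroˡ)
open import Data.Nat.Coprimality using (Coprime; coprime-divisor; coprime⇒gcd≡1) renaming (sym to coprime-sym)
open import Data.Nat.Primality using (Prime; prime; prime⇒irreducible; prime⇒nonZero)
open import Data.Nat.Tactic.RingSolver using (solve-∀)
open import Algebra.Properties.CommutativeSemigroup +-commutativeSemigroup
  using () renaming (interchange to +-interchange)
open import Data.List using (length; filter; _++_; [_])
open import Data.List.Base using (upTo)
open import Data.List.Properties using (upTo-∷ʳ; filter-++; length-++; length-filter; filter-some; length-upTo)
open import Data.List.Relation.Unary.Any using (here)
open import Data.Product using (_×_; _,_)
open import Data.Sum using (inj₁; inj₂)
open import Function.Base using (_∘_)
open import Function.Bundles using (_⇔_; mk⇔)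
open import Relation.Nullary using (Dec; yes; no; ¬_; contradiction)
open import Relation.Unary using (Pred; Decidable)
open import Relation.Binary.PropositionalEquality hiding ([_])

indicator : ∀ {a} {A : Set a} → Dec A → ℕ
indicator (yes _) = 1
indicator (no _)  = 0

indicator-yes : ∀ {a} {A : Set a} → A → (d : Dec A) → indicator d ≡ 1
indicator-yes x (yes _) = refl
indicator-yes x (no ¬x) = contradiction x ¬x

indicator-no : ∀ {a} {A : Set a} → ¬ A → (d : Dec A) → indicator d ≡ 0
indicator-no ¬x (yes x) = contradiction x ¬x
indicator-no ¬x (no _)  = refl

∑< : ℕ → (ℕ → ℕ) → ℕ
∑< zero    f = 0
∑< (suc n) f = ∑< n f + f n

∑<-+ : ∀ n f h → ∑< n (λ k → f k + h k) ≡ ∑< n f + ∑< n h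
∑<-+ zero    f h = refl
∑<-+ (suc n) f h rewrite ∑<-+ n f h = +-interchange (∑< n f) (∑< n h) (f n) (h n)

∑<-cong : ∀ n {f h} → (∀ k → f k ≡ h k) → ∑< n f ≡ ∑< n h
∑<-cong zero    eq = refl
∑<-cong (suc n) eq = cong₂ _+_ (∑<-cong n eq) (eq n)

∑<-1 : ∀ n → ∑< n (λ _ → 1) ≡ n
∑<-1 zero    = refl
∑<-1 (suc n) = trans (cong (_+ 1) (∑<-1 n)) (+-comm n 1)

length-filter-upTo : ∀ {ℓ} {P : Pred ℕ ℓ} (P? : Decidable P) n →
  length (filter P? (upTo n)) ≡ ∑< n (λ k → indicator (P? k))
length-filter-upTo P? zero    = refl
length-filter-upTo P? (suc n) = begin
  length (filter P? (upTo (suc n)))                       ≡⟨ cong (λ xs → length (filter P? xs)) (upTo-∷ʳ n) ⟨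
  length (filter P? (upTo n ++ [ n ]))                    ≡⟨ cong length (filter-++ P? (upTo n) [ n ]) ⟩
  length (filter P? (upTo n) ++ filter P? [ n ])          ≡⟨ length-++ (filter P? (upTo n)) ⟩
  length (filter P? (upTo n)) + length (filter P? [ n ])  ≡⟨ cong₂ _+_ (length-filter-upTo P? n) last ⟩
  ∑< n (λ k → indicator (P? k)) + indicator (P? n)        ∎
  where
  open ≡-Reasoning
  last : length (filter P? [ n ]) ≡ indicator (P? n)
  last with P? n
  ... | yes _ = refl
  ... | no _  = refl

∑<-multiples : ∀ d m .{{_ : NonZero d}} → ∑< (m * d) (λ k → indicator (d ∣? suc k)) ≡ m
∑<-multiples (suc e) m = below m 0 z≤n
  where
  d = suc e
  below : ∀ m r → r ≤ e → ∑< (r + m * d) (λ k → indicator (d ∣? suc k)) ≡ m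
  below zero    zero    _   = refl
  below (suc m) zero    _   =
    trans (cong₂ _+_ (below m e ≤-refl) (indicator-yes (divides (suc m) refl) (d ∣? suc (e + m * d))))
          (+-comm m 1)
  below m       (suc r) r<e =
    trans (cong₂ _+_ (below m r (≤-trans (n≤1+n r) r<e)) (indicator-no d∤ (d ∣? suc (r + m * d))))
          (+-identityʳ m)
    where
    d∤ : ¬ d ∣ suc r + m * d
    d∤ d∣ = <⇒≱ (s≤s r<e) (∣⇒≤ (∣m+n∣m⇒∣n (subst (d ∣_) (+-comm (suc r) (m * d)) d∣) (n∣m*n m)))

prime>1 : ∀ {p} → Prime p → 1 < p
prime>1 {p} (prime ⦃ nt ⦄ _) = nonTrivial⇒n>1 p ⦃ nt ⦄

∤prime⇒coprime : ∀ {p j} → Prime p → ¬ p ∣ j → Coprime j p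
∤prime⇒coprime pp p∤j (i∣j , i∣p) with prime⇒irreducible pp i∣p
... | inj₁ i≡1 = i≡1
... | inj₂ refl = contradiction i∣j p∤j

coprime-* : ∀ {a m n} → Coprime a m → Coprime a n → Coprime a (m * n)
coprime-* cm cn (i∣a , i∣mn) =
  cn (i∣a , coprime-divisor (λ (x∣i , x∣m) → cm (∣-trans x∣i i∣a , x∣m)) i∣mn)

coprime-^ : ∀ {a m} → Coprime a m → ∀ k → Coprime a (m ^ k)
coprime-^ cm zero    (_ , i∣1) = ∣1⇒≡1 i∣1
coprime-^ cm (suc k) = coprime-* cm (coprime-^ cm k)

primes-coprime : ∀ {p q} → Prime p → Prime q → p ≢ q → Coprime p q
primes-coprime pp pq p≢q (i∣p , i∣q) with prime⇒irreducible pp i∣p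
... | inj₁ i≡1 = i≡1
... | inj₂ refl with prime⇒irreducible pq i∣q
...   | inj₁ i≡1 = i≡1
...   | inj₂ i≡q = contradiction i≡q p≢q

coprime-∣-* : ∀ {p q j} → Coprime p q → p ∣ j → q ∣ j → p * q ∣ j
coprime-∣-* {p} {q} cpq (divides t refl) q∣tp =
  lift (coprime-divisor (coprime-sym cpq) (subst (q ∣_) (*-comm t p) q∣tp))
  where
  lift : q ∣ t → p * q ∣ t * p
  lift (divides u refl) = divides u (trans (*-assoc u q p) (cong (u *_) (*-comm q p)))

prime∣⇒gcd≢1 : ∀ {p j N} → Prime p → p ∣ N → p ∣ j → gcd j N ≢ 1
prime∣⇒gcd≢1 pp p∣N p∣j eq = >⇒≢ (prime>1 pp) (∣1⇒≡1 (subst (_ ∣_) eq (gcd-greatest p∣j p∣N)))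

φ-∑ : ∀ N → φ N ≡ ∑< N (λ k → indicator (gcd (suc k) N ≟ 1))
φ-∑ N = length-filter-upTo (λ k → gcd (suc k) N ≟ 1) N

φ≤ : ∀ N → φ N ≤ N
φ≤ N = subst (φ N ≤_) (length-upTo N) (length-filter (λ k → gcd (suc k) N ≟ 1) (upTo N))

φ>0 : ∀ n → 0 < φ (suc n)
φ>0 n = filter-some (λ k → gcd (suc k) (suc n) ≟ 1) {upTo (suc n)} (here (gcd-zeroˡ (suc n)))

coprime-indicator-prime : ∀ {p N} → Prime p → p ∣ N → (∀ j → ¬ p ∣ j → gcd j N ≡ 1) →
  ∀ j → indicator (gcd j N ≟ 1) + indicator (p ∣? j) ≡ 1
coprime-indicator-prime {p} {N} pp p∣N cop j with p ∣? j
... | yes p∣j rewrite indicator-no (prime∣⇒gcd≢1 pp p∣N p∣j) (gcd j N ≟ 1) = refl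
... | no p∤j  rewrite indicator-yes (cop j p∤j) (gcd j N ≟ 1) = refl

coprime-indicator-two-primes : ∀ {p q N} → Prime p → Prime q → Coprime p q → p ∣ N → q ∣ N →
  (∀ j → ¬ p ∣ j → ¬ q ∣ j → gcd j N ≡ 1) →
  ∀ j → indicator (gcd j N ≟ 1) + indicator (p ∣? j) + indicator (q ∣? j) ≡ 1 + indicator (p * q ∣? j)
coprime-indicator-two-primes {p} {q} {N} pp pq cpq p∣N q∣N cop j with p ∣? j | q ∣? j
... | yes p∣j | yes q∣j
  rewrite indicator-no (prime∣⇒gcd≢1 pp p∣N p∣j) (gcd j N ≟ 1)
        | indicator-yes (coprime-∣-* cpq p∣j q∣j) (p * q ∣? j) = refl
... | yes p∣j | no q∤j
  rewrite indicator-no (prime∣⇒gcd≢1 pp p∣N p∣j) (gcd j N ≟ 1)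
        | indicator-no (λ pq∣j → q∤j (∣-trans (n∣m*n p) pq∣j)) (p * q ∣? j) = refl
... | no p∤j  | yes q∣j
  rewrite indicator-no (prime∣⇒gcd≢1 pq q∣N q∣j) (gcd j N ≟ 1)
        | indicator-no (λ pq∣j → p∤j (∣-trans (m∣m*n q) pq∣j)) (p * q ∣? j) = refl
... | no p∤j  | no q∤j
  rewrite indicator-yes (cop j p∤j q∤j) (gcd j N ≟ 1)
        | indicator-no (λ pq∣j → p∤j (∣-trans (m∣m*n q) pq∣j)) (p * q ∣? j) = refl

φ-prime-power : ∀ {p} a → Prime p → φ (p ^ suc a) + p ^ a ≡ p ^ suc a
φ-prime-power {p} a pp = begin
  φ N + p ^ a                                          ≡⟨ cong₂ _+_ (φ-∑ N) (sym multiples-of-p) ⟩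
  ∑< N coprime + ∑< N (λ k → indicator (p ∣? suc k))   ≡⟨ ∑<-+ N coprime _ ⟨
  ∑< N (λ k → coprime k + indicator (p ∣? suc k))      ≡⟨ ∑<-cong N (λ k → coprime-indicator-prime pp p∣N cop (suc k)) ⟩
  ∑< N (λ _ → 1)                                       ≡⟨ ∑<-1 N ⟩
  N                                                    ∎
  where
  open ≡-Reasoning
  instance _ = prime⇒nonZero pp
  N = p ^ suc a
  coprime = λ k → indicator (gcd (suc k) N ≟ 1)
  p∣N = m∣m*n (p ^ a)
  cop : ∀ j → ¬ p ∣ j → gcd j N ≡ 1
  cop j p∤j = coprime⇒gcd≡1 (coprime-^ (∤prime⇒coprime pp p∤j) (suc a))
  multiples-of-p : ∑< N (λ k → indicator (p ∣? suc k)) ≡ p ^ a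
  multiples-of-p = trans (cong (λ n → ∑< n (λ k → indicator (p ∣? suc k))) (*-comm p (p ^ a)))
                         (∑<-multiples p (p ^ a))

φ-two-prime-powers : ∀ {p q} a c → Prime p → Prime q → p ≢ q →
  φ (p ^ suc a * q ^ suc c) + p ^ a * q ^ c * q + p ^ a * q ^ c * p ≡ p ^ suc a * q ^ suc c + p ^ a * q ^ c
φ-two-prime-powers {p} {q} a c pp pq p≢q = begin
  φ N + X * q + X * p                               ≡⟨ cong₂ _+_ (cong₂ _+_ (φ-∑ N) (sym (multiples p (X * q) N≡Xq*p)))
                                                                             (sym (multiples q (X * p) N≡Xp*q)) ⟩
  ∑< N coprime + ∑< N (mult p) + ∑< N (mult q)       ≡⟨ cong (_+ ∑< N (mult q)) (∑<-+ N coprime (mult p)) ⟨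
  ∑< N (λ k → coprime k + mult p k) + ∑< N (mult q)  ≡⟨ ∑<-+ N (λ k → coprime k + mult p k) (mult q) ⟨
  ∑< N (λ k → coprime k + mult p k + mult q k)       ≡⟨ ∑<-cong N (λ k → coprime-indicator-two-primes pp pq cpq p∣N q∣N cop (suc k)) ⟩
  ∑< N (λ k → 1 + mult (p * q) k)                    ≡⟨ ∑<-+ N (λ _ → 1) (mult (p * q)) ⟩
  ∑< N (λ _ → 1) + ∑< N (mult (p * q))               ≡⟨ cong₂ _+_ (∑<-1 N) (multiples (p * q) X ⦃ m*n≢0 p q ⦄ N≡X*pq) ⟩
  N + X                                              ∎
  where
  open ≡-Reasoning
  instance _ = prime⇒nonZero pp
  instance _ = prime⇒nonZero pq
  N = p ^ suc a * q ^ suc c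
  X = p ^ a * q ^ c
  cpq = primes-coprime pp pq p≢q
  coprime = λ k → indicator (gcd (suc k) N ≟ 1)
  mult : ℕ → ℕ → ℕ
  mult d k = indicator (d ∣? suc k)
  multiples : ∀ d m .{{_ : NonZero d}} → N ≡ m * d → ∑< N (mult d) ≡ m
  multiples d m N≡m*d = trans (cong (λ n → ∑< n (mult d)) N≡m*d) (∑<-multiples d m)
  N≡X*pq : N ≡ X * (p * q)
  N≡X*pq = shuffle p q (p ^ a) (q ^ c)
    where shuffle : ∀ p q P Q → p * P * (q * Q) ≡ P * Q * (p * q)
          shuffle = solve-∀
  N≡Xq*p : N ≡ X * q * p
  N≡Xq*p = trans N≡X*pq (trans (cong (X *_) (*-comm p q)) (sym (*-assoc X q p)))
  N≡Xp*q : N ≡ X * p * q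
  N≡Xp*q = trans N≡X*pq (sym (*-assoc X p q))
  p∣N = ∣-trans (m∣m*n (p ^ a)) (m∣m*n (q ^ suc c))
  q∣N = ∣-trans (m∣m*n (q ^ c)) (n∣m*n (p ^ suc a))
  cop : ∀ j → ¬ p ∣ j → ¬ q ∣ j → gcd j N ≡ 1
  cop j p∤j q∤j = coprime⇒gcd≡1 (coprime-* (coprime-^ (∤prime⇒coprime pp p∤j) (suc a))
                                           (coprime-^ (∤prime⇒coprime pq q∤j) (suc c)))

φ+k≡N+m⇒g+m≡k : ∀ N {k m} → φ N + k ≡ N + m → g N + m ≡ k
φ+k≡N+m⇒g+m≡k N {k} {m} eq = begin
  N ∸ φ N + m    ≡⟨ +-∸-comm m (φ≤ N) ⟨
  N + m ∸ φ N    ≡⟨ cong (_∸ φ N) eq ⟨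
  φ N + k ∸ φ N  ≡⟨ m+n∸m≡n (φ N) k ⟩
  k              ∎
  where open ≡-Reasoning

g<self : ∀ n → g (suc n) < suc n
g<self n with φ (suc n) | φ>0 n
... | suc t | _ = s≤s (m∸n≤m n t)

g-prime-power : ∀ {p} a → Prime p → g (p ^ suc a) ≡ p ^ a
g-prime-power {p} a pp =
  trans (sym (+-identityʳ _)) (φ+k≡N+m⇒g+m≡k (p ^ suc a) (trans (φ-prime-power a pp) (sym (+-identityʳ _))))

g-two-prime-powers : ∀ {p q} a c → Prime p → Prime q → p ≢ q →
  g (p ^ suc a * q ^ suc c) + p ^ a * q ^ c ≡ p ^ a * q ^ c * q + p ^ a * q ^ c * p
g-two-prime-powers {p} {q} a c pp pq p≢q =
  φ+k≡N+m⇒g+m≡k N (trans (sym (+-assoc (φ N) (X * q) (X * p))) (φ-two-prime-powers a c pp pq p≢q))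
  where
  N = p ^ suc a * q ^ suc c
  X = p ^ a * q ^ c

movesFuel-irrelevant : ∀ {f f′} n → n ≤ f → n ≤ f′ → movesFuel f n ≡ movesFuel f′ n
movesFuel-irrelevant {zero}  {zero}   zero _ _ = refl
movesFuel-irrelevant {zero}  {suc _}  zero _ _ = refl
movesFuel-irrelevant {suc _} {zero}   zero _ _ = refl
movesFuel-irrelevant {suc _} {suc _}  zero _ _ = refl
movesFuel-irrelevant {suc _} {suc _}  1    _ _ = refl
movesFuel-irrelevant {suc f} {suc f′} n@(suc (suc m)) (s≤s n≤1+f) (s≤s n≤1+f′) =
  cong suc (movesFuel-irrelevant (g n) (≤-trans g≤1+m n≤1+f) (≤-trans g≤1+m n≤1+f′))
  where
  g≤1+m : g n ≤ suc m
  g≤1+m = ≤-pred (g<self (suc m))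

moves-step : ∀ {n} → 2 ≤ n → moves n ≡ suc (moves (g n))
moves-step {n@(suc (suc m))} (s≤s (s≤s _)) = cong suc (movesFuel-irrelevant (g n) (≤-pred (g<self (suc m))) ≤-refl)

prime-power≥2 : ∀ {p} a → Prime p → 2 ≤ p ^ suc a
prime-power≥2 {p} a pp = ≤-trans (prime>1 pp) (m≤m*n p (p ^ a) ⦃ m^n≢0 p a ⦄)
  where instance _ = prime⇒nonZero pp

moves-prime-power : ∀ {p} → Prime p → ∀ m → moves (p ^ m) ≡ m
moves-prime-power pp zero    = refl
moves-prime-power {p} pp (suc m) = begin
  moves (p ^ suc m)            ≡⟨ moves-step (prime-power≥2 m pp) ⟩
  suc (moves (g (p ^ suc m)))  ≡⟨ cong (suc ∘ moves) (g-prime-power m pp) ⟩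
  suc (moves (p ^ m))          ≡⟨ cong suc (moves-prime-power pp m) ⟩
  suc m                        ∎
  where open ≡-Reasoning

module _ {p q b} (pp : Prime p) (pq : Prime q) (b≥2 : b ≥ 2) (q≡ : q ≡ p ^ b ∸ p + 1) where

  private instance _ = prime⇒nonZero pp

  p+q≡p^b+1 : p + q ≡ p ^ b + 1
  p+q≡p^b+1 = begin
    p + q                ≡⟨ cong (p +_) q≡ ⟩
    p + (p ^ b ∸ p + 1)  ≡⟨ +-assoc p (p ^ b ∸ p) 1 ⟨
    p + (p ^ b ∸ p) + 1  ≡⟨ cong (_+ 1) (m+[n∸m]≡n p≤p^b) ⟩
    p ^ b + 1            ∎
    where
    open ≡-Reasoning
    p≤p^b : p ≤ p ^ b
    p≤p^b = subst (_≤ p ^ b) (*-identityʳ p) (^-monoʳ-≤ p (≤-trans (n≤1+n 1) b≥2))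

  p≢q : p ≢ q
  p≢q p≡q = <⇒≢ p+p<p^b+1 (subst (λ x → p + x ≡ p ^ b + 1) (sym p≡q) p+q≡p^b+1)
    where
    open ≤-Reasoning
    p+p<p^b+1 : p + p < p ^ b + 1
    p+p<p^b+1 = begin-strict
      p + p      ≡⟨ cong (p +_) (+-identityʳ p) ⟨
      2 * p      ≤⟨ *-monoˡ-≤ p (prime>1 pp) ⟩
      p * p      ≡⟨ cong (p *_) (*-identityʳ p) ⟨
      p ^ 2      ≤⟨ ^-monoʳ-≤ p b≥2 ⟩
      p ^ b      <⟨ m<m+n (p ^ b) (s≤s z≤n) ⟩
      p ^ b + 1  ∎

  g-p^k*q^l : ∀ a c → g (p ^ suc a * q ^ suc c) ≡ p ^ (a + b) * q ^ c
  g-p^k*q^l a c = +-cancelʳ-≡ X _ _ (begin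
    g (p ^ suc a * q ^ suc c) + X  ≡⟨ g-two-prime-powers a c pp pq p≢q ⟩
    X * q + X * p                  ≡⟨ trans (*-distribˡ-+ X p q) (+-comm (X * p) (X * q)) ⟨
    X * (p + q)                    ≡⟨ cong (X *_) p+q≡p^b+1 ⟩
    X * (p ^ b + 1)                ≡⟨ trans (*-distribˡ-+ X (p ^ b) 1) (cong (X * p ^ b +_) (*-identityʳ X)) ⟩
    X * p ^ b + X                  ≡⟨ cong (_+ X) X*p^b≡ ⟩
    p ^ (a + b) * q ^ c + X        ∎)
    where
    open ≡-Reasoning
    X = p ^ a * q ^ c
    X*p^b≡ : X * p ^ b ≡ p ^ (a + b) * q ^ c
    X*p^b≡ = trans (*-comm-middle (p ^ a) (q ^ c) (p ^ b)) (cong (_* q ^ c) (sym (^-distribˡ-+-* p a b)))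
      where *-comm-middle : ∀ x y z → x * y * z ≡ x * z * y
            *-comm-middle = solve-∀

  moves-p^k*q^l : ∀ l {k} → 1 ≤ k → moves (p ^ k * q ^ l) ≡ k + l * b
  moves-p^k*q^l zero    {k}     _ = begin
    moves (p ^ k * 1)  ≡⟨ cong moves (*-identityʳ (p ^ k)) ⟩
    moves (p ^ k)      ≡⟨ moves-prime-power pp k ⟩
    k                  ≡⟨ +-identityʳ k ⟨
    k + 0              ∎
    where open ≡-Reasoning
  moves-p^k*q^l (suc c) {suc a} _ = begin
    moves (p ^ suc a * q ^ suc c)            ≡⟨ moves-step N≥2 ⟩
    suc (moves (g (p ^ suc a * q ^ suc c)))  ≡⟨ cong (suc ∘ moves) (g-p^k*q^l a c) ⟩
    suc (moves (p ^ (a + b) * q ^ c))        ≡⟨ cong suc (moves-p^k*q^l c a+b≥1) ⟩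
    suc (a + b + c * b)                      ≡⟨ cong suc (+-assoc a b (c * b)) ⟩
    suc a + suc c * b                        ∎
    where
    open ≡-Reasoning
    a+b≥1 : 1 ≤ a + b
    a+b≥1 = ≤-trans (≤-trans (s≤s z≤n) b≥2) (m≤n+m b a)
    N≥2 : 2 ≤ p ^ suc a * q ^ suc c
    N≥2 = ≤-trans (prime-power≥2 a pp) (m≤m*n (p ^ suc a) (q ^ suc c) ⦃ m^n≢0 q (suc c) ⦃ prime⇒nonZero pq ⦄ ⦄)

[m+n*o]%d≡[m+n*[o%d]]%d : ∀ m n o d .{{_ : NonZero d}} → (m + n * o) % d ≡ (m + n * (o % d)) % d
[m+n*o]%d≡[m+n*[o%d]]%d m n o d = begin
  (m + n * o) % d                  ≡⟨ %-distribˡ-+ m (n * o) d ⟩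
  (m % d + n * o % d) % d          ≡⟨ cong (λ t → (m % d + t) % d) n*o%d ⟩
  (m % d + n * (o % d) % d) % d    ≡⟨ %-distribˡ-+ m (n * (o % d)) d ⟨
  (m + n * (o % d)) % d            ∎
  where
  open ≡-Reasoning
  n*o%d : n * o % d ≡ n * (o % d) % d
  n*o%d = begin
    n * o % d                  ≡⟨ %-distribˡ-* n o d ⟩
    (n % d * (o % d)) % d      ≡⟨ cong (λ t → (n % d * t) % d) (m%n%n≡m%n o d) ⟨
    (n % d * (o % d % d)) % d  ≡⟨ %-distribˡ-* n (o % d) d ⟨
    n * (o % d) % d            ∎

≡⇒[≡0⇔≡0] : ∀ {x y : ℕ} → x ≡ y → (x ≡ 0 ⇔ y ≡ 0)
≡⇒[≡0⇔≡0] x≡y = mk⇔ (trans (sym x≡y)) (trans x≡y)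

mainTheorem3 : (p q b k l : ℕ) → Prime p → Prime q → b ≥ 2 → q ≡ p ^ b ∸ p + 1 → k ≥ 1 → l ≥ 1 →
    ((b % 2 ≡ 0 → (SG (p ^ k * q ^ l) ≡ 0 ⇔ k % 2 ≡ 0))
    × (b % 2 ≡ 1 → (SG (p ^ k * q ^ l) ≡ 0 ⇔ (k + l) % 2 ≡ 0)))
mainTheorem3 p q b k l pp pq b≥2 q≡ k≥1 _ =
    (λ b-even → ≡⇒[≡0⇔≡0] (trans (SG≡ b-even) (cong (_% 2) (trans (cong (k +_) (*-zeroʳ l)) (+-identityʳ k)))))
  , (λ b-odd  → ≡⇒[≡0⇔≡0] (trans (SG≡ b-odd) (cong (λ t → (k + t) % 2) (*-identityʳ l))))
  where
  SG≡ : ∀ {r} → b % 2 ≡ r → SG (p ^ k * q ^ l) ≡ (k + l * r) % 2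
  SG≡ refl = trans (cong (_% 2) (moves-p^k*q^l pp pq b≥2 q≡ l k≥1)) ([m+n*o]%d≡[m+n*[o%d]]%d k l b 2)
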